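{- Let $k\geq 1$ be an integer and let $G$ be a graph. If $f$ is an independent $[k]$-Roman dominating function of $G$ and $V_j=\{v\in V(G): f(v)=j\}$ for $0\le j\le k+1$, then $V_j=\emptyset$ for every $j\in\{1,2,\ldots,k-1\}$.
   Context: All graphs are finite and simple. For $v\in V(G)$, $N(v)$ is the open and $N[v]=N(v)\cup\{v\}$ the closed neighborhood. For $f\colon V(G)\to\mathbb{Z}_{\ge 0}$ and $S\subseteq V(G)$, $f(S)=\sum_{v\in S}f(v)$, and $AN(v)=\{w\in N(v): f(w)\ge 1\}$ (the active neighborhood of $v$). A $[k]$-Roman dominating function ($[k]$-RDF) of $G$ is a function $f\colon V(G)\to\{0,1,\ldots,k+1\}$ such that $f(N[v])\ge k+|AN(v)|$ for every vertex $v$ with $f(v)<k$. An independent $[k]$-Roman dominating function ($[k]$-IRDF) is a $[k]$-RDF $f$ such that the set $\{v: f(v)\ge 1\}$ is an independent set. -}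

module Defs where

open import Data.Nat using (ℕ; zero; suc; _+_; _≤_; _<_)
open import Data.Fin using (Fin)
open import Data.Bool using (Bool; true; false; if_then_else_)
open import Data.Vec.Functional using (Vector; foldr)
open import Relation.Binary.PropositionalEquality using (_≡_)
open import Data.Product using (_×_)

record Graph (n : ℕ) : Set where
  field
    adj    : Fin n → Fin n → Bool
    sym    : ∀ u v → adj u v ≡ adj v u
    irrefl : ∀ v → adj v v ≡ false
open Graph public

Σᵥ : ∀ {n} → (Fin n → ℕ) → ℕ
Σᵥ {n} g = foldr _+_ 0 g

fN : ∀ {n} → Graph n → (Fin n → ℕ) → Fin n → ℕ
fN G f v = Σᵥ (λ w → if adj G v w then f w else 0)

fNcl : ∀ {n} → Graph n → (Fin n → ℕ) → Fin n → ℕ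
fNcl G f v = f v + fN G f v

active : ℕ → ℕ
active zero    = 0
active (suc _) = 1

|AN| : ∀ {n} → Graph n → (Fin n → ℕ) → Fin n → ℕ
|AN| G f v = Σᵥ (λ w → if adj G v w then active (f w) else 0)

IsRDF : ∀ {n} → ℕ → Graph n → (Fin n → ℕ) → Set
IsRDF k G f =
  (∀ v → f v ≤ suc k) ×
  (∀ v → f v < k → k + |AN| G f v ≤ fNcl G f v)

ActiveIndependent : ∀ {n} → Graph n → (Fin n → ℕ) → Set
ActiveIndependent G f =
  ∀ u v → 1 ≤ f u → 1 ≤ f v → adj G u v ≡ false

IsIRDF : ∀ {n} → ℕ → Graph n → (Fin n → ℕ) → Set
IsIRDF k G f = IsRDF k G f × ActiveIndependent G f

{-# OPTIONS --safe #-}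
module Submission where

-- By independence an active vertex v has only inactive neighbours, so
-- f(N[v]) = f(v). If 0 < f(v) < k, the Roman condition at v would give
-- k ≤ k + |AN(v)| ≤ f(N[v]) = f(v) < k.

open import Defs hiding (sym)
open import Data.Nat using (ℕ; zero; suc; _≤_; _<_; _+_; s≤s; z≤n)
open import Data.Nat.Properties using (+-identityʳ; ≤-trans; m≤m+n; <⇒≱; ≮⇒≥; _<?_)
open import Data.Fin using (Fin; zero; suc)
open import Data.Bool using (true; false; if_then_else_)
open import Data.Product using (_,_)
open import Relation.Nullary using (¬_; yes; no)
open import Relation.Binary.PropositionalEquality
  using (_≡_; refl; subst; sym; trans; cong; module ≡-Reasoning)

Σᵥ-zero : ∀ {n} (g : Fin n → ℕ) → (∀ w → g w ≡ 0) → Σᵥ g ≡ 0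
Σᵥ-zero {zero}  g g≡0 = refl
Σᵥ-zero {suc n} g g≡0 rewrite g≡0 zero = Σᵥ-zero (λ w → g (suc w)) (λ w → g≡0 (suc w))

fN-zero : ∀ {n} (G : Graph n) (f : Fin n → ℕ) (v : Fin n) →
  (∀ w → adj G v w ≡ true → f w ≡ 0) → fN G f v ≡ 0
fN-zero G f v nbrs≡0 = Σᵥ-zero _ term≡0
  where
  term≡0 : ∀ w → (if adj G v w then f w else 0) ≡ 0
  term≡0 w with adj G v w in vw
  ... | true  = nbrs≡0 w vw
  ... | false = refl

neighbour-of-active-is-inactive : ∀ {n} (G : Graph n) (f : Fin n → ℕ) →
  ActiveIndependent G f → ∀ v → 1 ≤ f v → ∀ w → adj G v w ≡ true → f w ≡ 0
neighbour-of-active-is-inactive G f ind v 1≤fv w vw with f w in fw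
... | zero  = refl
... | suc _ with () ← trans (sym vw) (ind v w 1≤fv (subst (1 ≤_) (sym fw) (s≤s z≤n)))

fNcl-active : ∀ {n} (G : Graph n) (f : Fin n → ℕ) → ActiveIndependent G f →
  ∀ v → 1 ≤ f v → fNcl G f v ≡ f v
fNcl-active G f ind v 1≤fv = begin
  f v + fN G f v ≡⟨ cong (f v +_) (fN-zero G f v (neighbour-of-active-is-inactive G f ind v 1≤fv)) ⟩
  f v + 0        ≡⟨ +-identityʳ (f v) ⟩
  f v            ∎
  where open ≡-Reasoning

RDF-fNcl-≥ : ∀ {n} k (G : Graph n) (f : Fin n → ℕ) → IsRDF k G f →
  ∀ v → f v < k → k ≤ fNcl G f v
RDF-fNcl-≥ k G f (_ , dom) v fv<k = ≤-trans (m≤m+n k _) (dom v fv<k)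

IRDF-active-≥ : ∀ {n} k (G : Graph n) (f : Fin n → ℕ) → IsIRDF k G f →
  ∀ v → 1 ≤ f v → k ≤ f v
IRDF-active-≥ k G f (rdf , ind) v 1≤fv with f v <? k
... | no  fv≮k = ≮⇒≥ fv≮k
... | yes fv<k = subst (k ≤_) (fNcl-active G f ind v 1≤fv) (RDF-fNcl-≥ k G f rdf v fv<k)

proposition1p2 : (k : ℕ) → 1 ≤ k → (n : ℕ) → (G : Graph n) → (f : Fin n → ℕ) →
    IsIRDF k G f → (j : ℕ) → 1 ≤ j → j < k → (v : Fin n) → ¬ (f v ≡ j)
proposition1p2 k _ n G f irdf j 1≤j j<k v refl = <⇒≱ j<k (IRDF-active-≥ k G f irdf v 1≤j)
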